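{- Let $q\geq 2$ be an integer and let $\alpha$ be an irrational real number with $0<\alpha<1$. Then \[ \liminf_{n\to\infty}\frac{s_q(\lfloor n^{\alpha}\rfloor)}{s_q(n)}=0. \]
   Context: For an integer $q\geq 2$ and $n\in\mathbb{N}$, $s_q(n)$ denotes the sum of the digits of $n$ written in base $q$. $\lfloor x\rfloor$ is the floor of $x$. -}

module Defs where

open import Data.Nat using (ℕ; zero; suc; _+_; _*_; _^_; _≤_; _<_; NonZero)
open import Data.Nat.DivMod using (_/_; _%_)
open import Data.Integer using (∣_∣)
open import Data.Rational using (ℚ; ↥_; ↧ₙ_; 0ℚ; 1ℚ) renaming (_<_ to _<ℚ_)
open import Data.Product using (Σ; ∃; _×_)
open import Data.Sum using (_⊎_)
open import Relation.Nullary using (¬_)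

-- Base-q digit sum s_q(n).  Fuel n suffices since ⌊n/q⌋ < n for n ≥ 1, q ≥ 2.
digitSumFuel : (q : ℕ) → .{{_ : NonZero q}} → ℕ → ℕ → ℕ
digitSumFuel q zero    n = 0
digitSumFuel q (suc f) n = n % q + digitSumFuel q f (n / q)

s : (q : ℕ) → .{{_ : NonZero q}} → ℕ → ℕ
s q n = digitSumFuel q n n

record Real : Set₁ where
  field
    L : ℚ → Set
    U : ℚ → Set
    inhabitedL : ∃ λ r → L r
    inhabitedU : ∃ λ r → U r
    roundedL₁ : ∀ r → L r → ∃ λ t → r <ℚ t × L t
    roundedL₂ : ∀ r t → r <ℚ t → L t → L r
    roundedU₁ : ∀ r → U r → ∃ λ t → t <ℚ r × U t
    roundedU₂ : ∀ r t → t <ℚ r → U t → U r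
    disjoint  : ∀ r → ¬ (L r × U r)
    located   : ∀ r t → r <ℚ t → L r ⊎ U t
open Real public

Irrational : Real → Set
Irrational α = ∀ r → L α r ⊎ U α r

InUnitInterval : Real → Set
InUnitInterval α = L α 0ℚ × U α 1ℚ

-- For α > 0:  m ≤ n^α  iff  m ≤ n^r for every rational r > α,
-- i.e. m^b ≤ n^a for every a/b > α (such a/b are positive).
LePow : ℕ → ℕ → Real → Set
LePow m n α = ∀ r → U α r → m ^ (↧ₙ r) ≤ n ^ ∣ ↥ r ∣

IsFloorPow : ℕ → Real → ℕ → Set
IsFloorPow n α m = LePow m n α × ¬ LePow (suc m) n α

module Submission where

-- Given k and N we exhibit n > N such that x = ⌊n^α⌋ is a power q^t, so s_q(x) = 1,
-- while n ends in k+2 base-q digits q-1, so s_q(n) ≥ k+2.  Every block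
-- [y·H, (y+1)·H) with H = q^(k+2) contains such a number, so it suffices to find a
-- whole block on which ⌊n^α⌋ = x.
--
-- For D = x·E we trap α between
-- consecutive fractions D/(c+1) < α < D/c (irrationality lets us scan for c); then
-- x^(c+1) ≤ n^D < (x+1)^c forces ⌊n^α⌋ = x.  This window of D-th powers contains a
-- block of length H: its endpoints differ by a factor ≥ 2 (Bernoulli, as c ≥ x·E),
-- the D-th powers of consecutive multiples zH, (z+2)H differ by a factor ≤ 2 once
-- z ≥ 4D, and a rational bound α < a/(a+1) < 1 puts the bottom of the window far
-- above (4·D·H)^D when t is large.

open import Defs
open import Data.Nat using (ℕ; suc; _*_; _≤_; _<_; NonZero)
open import Data.Product using (∃; _×_; _,_)
open import Data.Nat using (zero; _+_; _^_; pred; z≤n; s≤s; z<s; _<?_; _≤?_; >-nonZero; >-nonZero⁻¹)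
open import Data.Nat.Properties
open import Data.Nat.DivMod using (_/_; _%_; m/n<m; [m+kn]%n≡m%n; m<n⇒m%n≡m; 0/n≡0; m<n⇒m/n≡0; m*n/n≡m; +-distrib-/-∣ʳ)
open import Data.Nat.Divisibility using (divides-refl)
open import Relation.Binary.PropositionalEquality
open import Relation.Nullary using (¬_; yes; no; contradiction)
open import Relation.Unary using (Decidable)
open import Relation.Binary.Definitions using (tri<; tri≈; tri>)
open import Data.Sum using (inj₁; inj₂)
open import Data.Nat.Tactic.RingSolver using (solve-∀)
open import Data.Integer as ℤ using (∣_∣)
import Data.Integer.Properties as ℤP
open import Data.Rational as ℚ using (ℚ; ↥_; ↧_; ↧ₙ_; 0ℚ; 1ℚ; toℚᵘ; fromℚᵘ)
import Data.Rational.Properties as ℚP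
open import Data.Rational.Unnormalised as ℚᵘ using (mkℚᵘ)
import Data.Rational.Unnormalised.Properties as ℚᵘP

module DigitSum (q : ℕ) .{{_ : NonZero q}} (1<q : 1 < q) where

  digitSumFuel-zero : ∀ f → digitSumFuel q f 0 ≡ 0
  digitSumFuel-zero zero    = refl
  digitSumFuel-zero (suc f) =
    cong₂ _+_ (m<n⇒m%n≡m 0<q) (trans (cong (digitSumFuel q f) (0/n≡0 q)) (digitSumFuel-zero f))
    where
    0<q : 0 < q
    0<q = <-trans z<s 1<q

  digitSumFuel-enough : ∀ f g n → n ≤ f → n ≤ g → digitSumFuel q f n ≡ digitSumFuel q g n
  digitSumFuel-enough f g zero _ _ = trans (digitSumFuel-zero f) (sym (digitSumFuel-zero g))
  digitSumFuel-enough (suc f) (suc g) n@(suc _) (s≤s n≤f) (s≤s n≤g) =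
    cong (n % q +_) (digitSumFuel-enough f g (n / q) (≤-trans n/q≤pn n≤f) (≤-trans n/q≤pn n≤g))
    where
    n/q≤pn : n / q ≤ pred n
    n/q≤pn = ≤-pred (m/n<m n q 1<q)

  s-appendDigit : ∀ d x → d < q → s q (d + x * q) ≡ d + s q x
  s-appendDigit d x d<q = begin
      s q y                                ≡⟨ digitSumFuel-enough y (suc y) y ≤-refl (n≤1+n y) ⟩
      y % q + digitSumFuel q y (y / q)     ≡⟨ cong₂ (λ r m → r + digitSumFuel q y m) last rest ⟩
      d + digitSumFuel q y x               ≡⟨ cong (d +_) (digitSumFuel-enough y x x x≤y ≤-refl) ⟩
      d + s q x                            ∎
    where
    open ≡-Reasoning
    y = d + x * q
    last : y % q ≡ d
    last = trans ([m+kn]%n≡m%n d x q) (m<n⇒m%n≡m d<q)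
    rest : y / q ≡ x
    rest = trans (+-distrib-/-∣ʳ d (divides-refl x)) (cong₂ _+_ (m<n⇒m/n≡0 d<q) (m*n/n≡m x q))
    x≤y : x ≤ y
    x≤y = ≤-trans (m≤m*n x q) (m≤n+m (x * q) d)

  s-pow : ∀ t → s q (q ^ t) ≡ 1
  s-pow zero    = s-appendDigit 1 0 1<q
  s-pow (suc t) = begin
      s q (q * q ^ t)     ≡⟨ cong (s q) (*-comm q (q ^ t)) ⟩
      s q (0 + q ^ t * q) ≡⟨ s-appendDigit 0 (q ^ t) (<-trans z<s 1<q) ⟩
      s q (q ^ t)         ≡⟨ s-pow t ⟩
      1                   ∎
    where open ≡-Reasoning

  appendMaxDigits : ℕ → ℕ → ℕ
  appendMaxDigits zero    y = y
  appendMaxDigits (suc j) y = pred q + appendMaxDigits j y * q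

  s-appendMaxDigits : ∀ j y → s q (appendMaxDigits j y) ≡ j * pred q + s q y
  s-appendMaxDigits zero    y = refl
  s-appendMaxDigits (suc j) y = begin
      s q (pred q + appendMaxDigits j y * q)  ≡⟨ s-appendDigit (pred q) (appendMaxDigits j y) (pred[n]<n q) ⟩
      pred q + s q (appendMaxDigits j y)      ≡⟨ cong (pred q +_) (s-appendMaxDigits j y) ⟩
      pred q + (j * pred q + s q y)           ≡⟨ +-assoc (pred q) (j * pred q) (s q y) ⟨
      suc j * pred q + s q y                  ∎
    where
    open ≡-Reasoning
    pred[n]<n : ∀ n .{{_ : NonZero n}} → pred n < n
    pred[n]<n (suc n) = n<1+n n

  appendMaxDigits-s≥ : ∀ j y → j ≤ s q (appendMaxDigits j y)
  appendMaxDigits-s≥ j y = begin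
      j                       ≡⟨ *-identityʳ j ⟨
      j * 1                   ≤⟨ *-monoʳ-≤ j (suc[m]≤n⇒m≤pred[n] 1<q) ⟩
      j * pred q              ≤⟨ m≤m+n (j * pred q) (s q y) ⟩
      j * pred q + s q y      ≡⟨ s-appendMaxDigits j y ⟨
      s q (appendMaxDigits j y) ∎
    where open ≤-Reasoning

  appendMaxDigits-lower : ∀ j y → y * q ^ j ≤ appendMaxDigits j y
  appendMaxDigits-lower zero    y = ≤-reflexive (*-identityʳ y)
  appendMaxDigits-lower (suc j) y = begin
      y * (q * q ^ j) ≡⟨ cong (y *_) (*-comm q (q ^ j)) ⟩
      y * (q ^ j * q) ≡⟨ *-assoc y (q ^ j) q ⟨
      y * q ^ j * q   ≤⟨ *-monoˡ-≤ q (appendMaxDigits-lower j y) ⟩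
      appendMaxDigits j y * q   ≤⟨ m≤n+m _ (pred q) ⟩
      appendMaxDigits (suc j) y ∎
    where open ≤-Reasoning

  appendMaxDigits-upper : ∀ j y → appendMaxDigits j y < suc y * q ^ j
  appendMaxDigits-upper zero    y = ≤-reflexive (cong suc (sym (*-identityʳ y)))
  appendMaxDigits-upper (suc j) y = begin
      suc (appendMaxDigits (suc j) y) ≡⟨ cong (_+ appendMaxDigits j y * q) (suc-pred q) ⟩
      suc (appendMaxDigits j y) * q   ≤⟨ *-monoˡ-≤ q (appendMaxDigits-upper j y) ⟩
      suc y * q ^ j * q               ≡⟨ trans (*-assoc (suc y) (q ^ j) q) (cong (suc y *_) (*-comm (q ^ j) q)) ⟩
      suc y * (q * q ^ j)             ∎
    where open ≤-Reasoning

-- Inequalities between powers of natural numbers.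

^-distribʳ-* : ∀ m n e → (m * n) ^ e ≡ m ^ e * n ^ e
^-distribʳ-* m n zero    = refl
^-distribʳ-* m n (suc e) = trans (cong (m * n *_) (^-distribʳ-* m n e)) (interchange m n (m ^ e) (n ^ e))
  where
  interchange : ∀ a b c d → a * b * (c * d) ≡ a * c * (b * d)
  interchange = solve-∀

^-swap : ∀ m a b → (m ^ a) ^ b ≡ (m ^ b) ^ a
^-swap m a b = trans (^-*-assoc m a b) (trans (cong (m ^_) (*-comm a b)) (sym (^-*-assoc m b a)))

^-cancelˡ-≤ : ∀ e .{{_ : NonZero e}} {m n} → m ^ e ≤ n ^ e → m ≤ n
^-cancelˡ-≤ e {m} {n} mᵉ≤nᵉ with m ≤? n
... | yes m≤n = m≤n
... | no  m≰n = contradiction mᵉ≤nᵉ (<⇒≱ (^-monoˡ-< e (≰⇒> m≰n)))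

^-cancelˡ-< : ∀ e {m n} → m ^ e < n ^ e → m < n
^-cancelˡ-< e {m} {n} mᵉ<nᵉ with m <? n
... | yes m<n = m<n
... | no  m≮n = contradiction mᵉ<nᵉ (≤⇒≯ (^-monoˡ-≤ e (≮⇒≥ m≮n)))

m≤m^n : ∀ m n → .{{_ : NonZero n}} → m ≤ m ^ n
m≤m^n zero    (suc n) = z≤n
m≤m^n (suc m) (suc n) = m≤m*n (suc m) (suc m ^ n) {{m^n≢0 (suc m) n}}

-- If W^a < x and D·(a+1) ≤ (c+1)·a then (x·W)^D < x^(c+1): raising to the a-th power,
-- (xW)^(Da) = (x^a·W^a)^D < (x^(a+1))^D ≤ x^((c+1)a).
power-gap : ∀ x W a c D → .{{_ : NonZero D}} → W ^ a < x → D * suc a ≤ suc c * a → (x * W) ^ D < x ^ suc c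
power-gap x W a c D Wᵃ<x slope = ^-cancelˡ-< a (begin-strict
    ((x * W) ^ D) ^ a     ≡⟨ ^-swap (x * W) D a ⟩
    ((x * W) ^ a) ^ D     ≡⟨ cong (_^ D) (^-distribʳ-* x W a) ⟩
    (x ^ a * W ^ a) ^ D   <⟨ ^-monoˡ-< D (*-monoʳ-< (x ^ a) {{m^n≢0 x a}} Wᵃ<x) ⟩
    (x ^ a * x) ^ D       ≡⟨ cong (_^ D) (*-comm (x ^ a) x) ⟩
    (x ^ suc a) ^ D       ≡⟨ ^-*-assoc x (suc a) D ⟩
    x ^ (suc a * D)       ≤⟨ ^-monoʳ-≤ x (≤-trans (≤-reflexive (*-comm (suc a) D)) slope) ⟩
    x ^ (suc c * a)       ≡⟨ ^-*-assoc x (suc c) a ⟨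
    (x ^ suc c) ^ a       ∎)
  where
  open ≤-Reasoning
  instance
    x≢0 : NonZero x
    x≢0 = >-nonZero (<-≤-trans z<s Wᵃ<x)

-- Bernoulli's inequality, multiplied out:  x·(x+1)^n ≥ x^(n+1) + n·x^n.
bernoulli : ∀ x n → x ^ suc n + n * x ^ n ≤ x * suc x ^ n
bernoulli x zero    = ≤-reflexive (+-identityʳ (x * 1))
bernoulli x (suc n) = begin
    x ^ suc (suc n) + suc n * x ^ suc n                 ≤⟨ m≤m+n _ (n * x ^ n) ⟩
    x ^ suc (suc n) + suc n * x ^ suc n + n * x ^ n     ≡⟨ expand x n (x ^ n) ⟩
    suc x * (x ^ suc n + n * x ^ n)                     ≤⟨ *-monoʳ-≤ (suc x) (bernoulli x n) ⟩
    suc x * (x * suc x ^ n)                             ≡⟨ x∙y∙z≡y∙x∙z (suc x) x (suc x ^ n) ⟩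
    x * suc x ^ suc n                                   ∎
  where
  open ≤-Reasoning
  expand : ∀ x n y → x * (x * y) + suc n * (x * y) + n * y ≡ suc x * (x * y + n * y)
  expand = solve-∀
  x∙y∙z≡y∙x∙z : ∀ a b c → a * (b * c) ≡ b * (a * c)
  x∙y∙z≡y∙x∙z = solve-∀

succ^self-doubles : ∀ x .{{_ : NonZero x}} → 2 * x ^ x ≤ suc x ^ x
succ^self-doubles x = *-cancelˡ-≤ x (begin
    x * (2 * x ^ x)       ≡⟨ double x (x ^ x) ⟩
    x * x ^ x + x * x ^ x ≤⟨ bernoulli x x ⟩
    x * suc x ^ x         ∎)
  where
  open ≤-Reasoning
  double : ∀ x y → x * (2 * y) ≡ x * y + x * y
  double = solve-∀

succ^-grows : ∀ x .{{_ : NonZero x}} e → 2 ^ e * x ^ (x * e) ≤ suc x ^ (x * e)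
succ^-grows x zero    =
  ≤-reflexive (trans (cong (λ i → 1 * x ^ i) (*-zeroʳ x)) (cong (suc x ^_) (sym (*-zeroʳ x))))
succ^-grows x (suc e) = begin
    2 ^ suc e * x ^ (x * suc e)              ≡⟨ cong (λ i → 2 ^ suc e * x ^ i) (*-suc x e) ⟩
    2 * 2 ^ e * x ^ (x + x * e)              ≡⟨ cong (2 * 2 ^ e *_) (^-distribˡ-+-* x x (x * e)) ⟩
    2 * 2 ^ e * (x ^ x * x ^ (x * e))        ≡⟨ interchange 2 (2 ^ e) (x ^ x) (x ^ (x * e)) ⟩
    2 * x ^ x * (2 ^ e * x ^ (x * e))        ≤⟨ *-mono-≤ (succ^self-doubles x) (succ^-grows x e) ⟩
    suc x ^ x * suc x ^ (x * e)              ≡⟨ ^-distribˡ-+-* (suc x) x (x * e) ⟨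
    suc x ^ (x + x * e)                      ≡⟨ cong (suc x ^_) (*-suc x e) ⟨
    suc x ^ (x * suc e)                      ∎
  where
  open ≤-Reasoning
  interchange : ∀ a b c d → a * b * (c * d) ≡ a * c * (b * d)
  interchange = solve-∀

-- If c ≥ x·E and 2x ≤ 2^E then (x+1)^c ≥ 2·x^(c+1), since
-- ((x+1)/x)^c ≥ ((x+1)/x)^(xE) ≥ 2^E ≥ 2x.
succ^-beats : ∀ x .{{_ : NonZero x}} E c → x * E ≤ c → 2 * x ≤ 2 ^ E → 2 * x ^ suc c ≤ suc x ^ c
succ^-beats x E c xE≤c 2x≤2ᴱ with m≤n⇒∃[o]m+o≡n xE≤c
... | r , refl = begin
    2 * (x * x ^ (x * E + r))            ≡⟨ cong (λ y → 2 * (x * y)) (^-distribˡ-+-* x (x * E) r) ⟩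
    2 * (x * (x ^ (x * E) * x ^ r))      ≡⟨ reassoc 2 x (x ^ (x * E)) (x ^ r) ⟩
    2 * x * x ^ (x * E) * x ^ r          ≤⟨ *-monoˡ-≤ (x ^ r) (*-monoˡ-≤ (x ^ (x * E)) 2x≤2ᴱ) ⟩
    2 ^ E * x ^ (x * E) * x ^ r          ≤⟨ *-mono-≤ (succ^-grows x E) (^-monoˡ-≤ r (n≤1+n x)) ⟩
    suc x ^ (x * E) * suc x ^ r          ≡⟨ ^-distribˡ-+-* (suc x) (x * E) r ⟨
    suc x ^ (x * E + r)                  ∎
  where
  open ≤-Reasoning
  reassoc : ∀ a b c d → a * (b * (c * d)) ≡ a * b * c * d
  reassoc = solve-∀

n<2^n : ∀ n → n < 2 ^ n
n<2^n zero    = z<s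
n<2^n (suc n) = ≤-trans (+-mono-≤ (m^n>0 2 n) (n<2^n n)) (≤-reflexive (cong (2 ^ n +_) (sym (+-identityʳ (2 ^ n)))))

double-pow≤ : ∀ q t → 2 * q ^ t ≤ 2 ^ suc (t * q)
double-pow≤ q t = *-monoʳ-≤ 2 (begin
    q ^ t        ≤⟨ ^-monoˡ-≤ t (<⇒≤ (n<2^n q)) ⟩
    (2 ^ q) ^ t  ≡⟨ ^-*-assoc 2 q t ⟩
    2 ^ (q * t)  ≡⟨ cong (2 ^_) (*-comm q t) ⟩
    2 ^ (t * q)  ∎)
  where open ≤-Reasoning

square≤2^ : ∀ v → (4 + v) * (4 + v) ≤ 2 ^ (4 + v)
square≤2^ zero    = ≤-refl
square≤2^ (suc v) = begin
    (5 + v) * (5 + v)                           ≤⟨ m≤m+n _ (v * v + 6 * v + 7) ⟩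
    (5 + v) * (5 + v) + (v * v + 6 * v + 7)     ≡⟨ expand v ⟩
    2 * ((4 + v) * (4 + v))                     ≤⟨ *-monoʳ-≤ 2 (square≤2^ v) ⟩
    2 * 2 ^ (4 + v)                             ∎
  where
  open ≤-Reasoning
  expand : ∀ v → (5 + v) * (5 + v) + (v * v + 6 * v + 7) ≡ 2 * ((4 + v) * (4 + v))
  expand = solve-∀

-- A discrete form of (1 + h/z)^D ≤ z/(z - hD):  if hD + w ≤ z then (z+h)^D·w ≤ z^D·z.
shift^ : ∀ h D w z → h * D + w ≤ z → (z + h) ^ D * w ≤ z ^ D * z
shift^ h zero    w z hD+w≤z = *-monoʳ-≤ 1 (≤-trans (m≤n+m w (h * 0)) hD+w≤z)
shift^ h (suc D) w z hD+w≤z = begin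
    (z + h) * (z + h) ^ D * w          ≡⟨ x∙y∙z≡y∙[x∙z] (z + h) ((z + h) ^ D) w ⟩
    (z + h) ^ D * ((z + h) * w)        ≤⟨ *-monoʳ-≤ ((z + h) ^ D) one-step ⟩
    (z + h) ^ D * (z * (w + h))        ≡⟨ x∙[y∙z]≡y∙[x∙z] ((z + h) ^ D) z (w + h) ⟩
    z * ((z + h) ^ D * (w + h))        ≤⟨ *-monoʳ-≤ z (shift^ h D (w + h) z (subst (_≤ z) (sym (regroup h D w)) hD+w≤z)) ⟩
    z * (z ^ D * z)                    ≡⟨ *-assoc z (z ^ D) z ⟨
    z * z ^ D * z                      ∎
  where
  open ≤-Reasoning
  x∙y∙z≡y∙[x∙z] : ∀ a b c → a * b * c ≡ b * (a * c)
  x∙y∙z≡y∙[x∙z] = solve-∀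
  x∙[y∙z]≡y∙[x∙z] : ∀ a b c → a * (b * c) ≡ b * (a * c)
  x∙[y∙z]≡y∙[x∙z] = solve-∀
  regroup : ∀ h D w → h * D + (w + h) ≡ h * suc D + w
  regroup = solve-∀
  -- (z + h)·w ≤ z·(w + h) amounts to h·w ≤ h·z
  one-step : (z + h) * w ≤ z * (w + h)
  one-step = begin
    (z + h) * w   ≡⟨ *-distribʳ-+ w z h ⟩
    z * w + h * w ≤⟨ +-monoʳ-≤ (z * w) (*-monoʳ-≤ h (≤-trans (m≤n+m w (h * suc D)) hD+w≤z)) ⟩
    z * w + h * z ≡⟨ factor z w h ⟩
    z * (w + h)   ∎
    where
    factor : ∀ z w h → z * w + h * z ≡ z * (w + h)
    factor = solve-∀

-- For z ≥ 4D, (z + 2)^D ≤ 2·z^D: apply shift^ with h = 2 and w = z - 2D ≥ z/2.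
shift^-by-two : ∀ D z .{{_ : NonZero z}} → 4 * D ≤ z → (z + 2) ^ D ≤ 2 * z ^ D
shift^-by-two D z 4D≤z with m≤n⇒∃[o]m+o≡n 4D≤z
... | v , refl = *-cancelʳ-≤ _ _ z (begin
    (z + 2) ^ D * z              ≤⟨ *-monoʳ-≤ ((z + 2) ^ D) (≤-trans (m≤m+n z v) (≤-reflexive (z+v≡w+w D v))) ⟩
    (z + 2) ^ D * (w + w)        ≡⟨ *-distribˡ-+ ((z + 2) ^ D) w w ⟩
    (z + 2) ^ D * w + (z + 2) ^ D * w ≤⟨ +-mono-≤ shifted shifted ⟩
    z ^ D * z + z ^ D * z        ≡⟨ twice (z ^ D) z ⟩
    2 * z ^ D * z                ∎)
  where
  open ≤-Reasoning
  w = 2 * D + v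
  z+v≡w+w : ∀ D v → 4 * D + v + v ≡ (2 * D + v) + (2 * D + v)
  z+v≡w+w = solve-∀
  shifted : (z + 2) ^ D * w ≤ z ^ D * z
  shifted = shift^ 2 D w z (≤-reflexive (2D+w≡z D v))
    where
    2D+w≡z : ∀ D v → 2 * D + (2 * D + v) ≡ 4 * D + v
    2D+w≡z = solve-∀
  twice : ∀ a b → a * b + a * b ≡ 2 * a * b
  twice = solve-∀

-- Locating a block of consecutive integers whose D-th powers lie in a prescribed interval.

crossing : ∀ {P : ℕ → Set} → Decidable P → ∀ a d → ¬ P a → P (a + d) →
           ∃ λ z → a ≤ z × ¬ P z × P (suc z)
crossing {P} P? a zero    ¬Pa Pa+0 = contradiction (subst P (+-identityʳ a) Pa+0) ¬Pa
crossing {P} P? a (suc d) ¬Pa Pa+d+1 with P? (suc a)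
... | yes Psa = a , ≤-refl , ¬Pa , Psa
... | no ¬Psa with crossing P? (suc a) d ¬Psa (subst P (+-suc a d) Pa+d+1)
...   | z , 1+a≤z , ¬Pz , Psz = z , ≤-trans (n≤1+n a) 1+a≤z , ¬Pz , Psz

-- If (4·D·H)^D < x^(c+1) and 2·x^(c+1) ≤ (x+1)^c, then for some
-- y > 4D all n ∈ [y·H, (y+1)·H) satisfy x^(c+1) ≤ n^D < (x+1)^c.  Take y = z+1 where zH
-- is the last multiple of H with (zH)^D < x^(c+1); as z ≥ 4D, ((z+2)H)^D ≤ 2·(zH)^D.
window : ∀ x c D H → .{{_ : NonZero D}} → .{{_ : NonZero H}} →
         (4 * D * H) ^ D < x ^ suc c → 2 * x ^ suc c ≤ suc x ^ c →
         ∃ λ y → 4 * D < y × (∀ n → y * H ≤ n → n < suc y * H → x ^ suc c ≤ n ^ D × n ^ D < suc x ^ c)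
window x c D H gap doubling =
  let z , 4D≤z , ¬Pz , P1+z = crossing P? (4 * D) (x ^ suc c) (<⇒≱ gap) eventually
  in  suc z , s≤s 4D≤z , inWindow z 4D≤z (≰⇒> ¬Pz) P1+z
  where
  P : ℕ → Set
  P z = x ^ suc c ≤ (z * H) ^ D
  P? : Decidable P
  P? z = x ^ suc c ≤? (z * H) ^ D
  eventually : P (4 * D + x ^ suc c)
  eventually = begin
    x ^ suc c                             ≤⟨ m≤n+m _ (4 * D) ⟩
    4 * D + x ^ suc c                     ≤⟨ m≤m*n _ H ⟩
    (4 * D + x ^ suc c) * H               ≤⟨ m≤m^n _ D ⟩
    ((4 * D + x ^ suc c) * H) ^ D         ∎
    where open ≤-Reasoning
  inWindow : ∀ z → 4 * D ≤ z → (z * H) ^ D < x ^ suc c → P (suc z) →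
             ∀ n → suc z * H ≤ n → n < suc (suc z) * H → x ^ suc c ≤ n ^ D × n ^ D < suc x ^ c
  inWindow z 4D≤z below atLeast n lo hi = ≤-trans atLeast (^-monoˡ-≤ D lo) , (begin-strict
      n ^ D                      <⟨ ^-monoˡ-< D hi ⟩
      (suc (suc z) * H) ^ D      ≡⟨ cong (λ w → (w * H) ^ D) (+-comm 2 z) ⟩
      ((z + 2) * H) ^ D          ≡⟨ ^-distribʳ-* (z + 2) H D ⟩
      (z + 2) ^ D * H ^ D        ≤⟨ *-monoˡ-≤ (H ^ D) (shift^-by-two D z {{z≢0}} 4D≤z) ⟩
      2 * z ^ D * H ^ D          ≡⟨ *-assoc 2 (z ^ D) (H ^ D) ⟩
      2 * (z ^ D * H ^ D)        ≡⟨ cong (2 *_) (^-distribʳ-* z H D) ⟨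
      2 * (z * H) ^ D            ≤⟨ *-monoʳ-≤ 2 (<⇒≤ below) ⟩
      2 * x ^ suc c              ≤⟨ doubling ⟩
      suc x ^ c                  ∎)
    where
    open ≤-Reasoning
    z≢0 : NonZero z
    z≢0 = >-nonZero (<-≤-trans (*-monoʳ-< 4 (>-nonZero⁻¹ D)) 4D≤z)

-- Fractions a/(b+1), compared with arbitrary rationals in cross-multiplied form over ℕ.

-- frac a b = a/(b+1).
frac : ℕ → ℕ → ℚ
frac a b = fromℚᵘ (mkℚᵘ (ℤ.+ a) b)

<⇒<∣∣ : ∀ {m} i → ℤ.+ m ℤ.< i → m < ∣ i ∣
<⇒<∣∣ (ℤ.+ n) (ℤ.+<+ m<n) = m<n

frac<⇒ : ∀ a b r → frac a b ℚ.< r → a * ↧ₙ r < ∣ ↥ r ∣ * suc b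
frac<⇒ a b r@record{} lt with ℚᵘP.<-respˡ-≃ (ℚP.toℚᵘ-fromℚᵘ (mkℚᵘ (ℤ.+ a) b)) (ℚP.toℚᵘ-mono-< lt)
... | ℚᵘ.*<* cross = subst (a * ↧ₙ r <_) (ℤP.abs-* (↥ r) (ℤ.+ suc b))
                       (<⇒<∣∣ (↥ r ℤ.* ℤ.+ suc b) (subst (ℤ._< _) (sym (ℤP.pos-* a (↧ₙ r))) cross))

<frac⇒ : ∀ a b r → 0ℚ ℚ.< r → r ℚ.< frac a b → ∣ ↥ r ∣ * suc b < a * ↧ₙ r
<frac⇒ a b r@(ℚ.mkℚ (ℤ.+ m) _ _) _ lt with ℚᵘP.<-respʳ-≃ (ℚP.toℚᵘ-fromℚᵘ (mkℚᵘ (ℤ.+ a) b)) (ℚP.toℚᵘ-mono-< lt)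
... | ℚᵘ.*<* cross = ℤP.drop‿+<+ (subst₂ ℤ._<_ (sym (ℤP.pos-* m (suc b))) (sym (ℤP.pos-* a (↧ₙ r))) cross)
<frac⇒ _ _ (ℚ.mkℚ ℤ.-[1+ m ] _ _) (ℚ.*<* ()) _

frac-cross : ∀ a b → ∣ ↥ frac a b ∣ * suc b ≡ a * ↧ₙ frac a b
frac-cross a b = cross (frac a b) (ℚP.toℚᵘ-fromℚᵘ (mkℚᵘ (ℤ.+ a) b))
  where
  cross : ∀ r → toℚᵘ r ℚᵘ.≃ mkℚᵘ (ℤ.+ a) b → ∣ ↥ r ∣ * suc b ≡ a * ↧ₙ r
  cross r@record{} (ℚᵘ.*≡* eq) = trans (sym (ℤP.abs-* (↥ r) (ℤ.+ suc b))) (trans (cong ∣_∣ eq) (ℤP.abs-* (ℤ.+ a) (↧ r)))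

-- Trapping α between consecutive fractions, and reading off ⌊n^α⌋ from such a trap.

L<U : ∀ α {r t} → L α r → U α t → r ℚ.< t
L<U α {r} {t} Lr Ut with ℚP.<-cmp r t
... | tri< r<t _ _ = r<t
... | tri≈ _ refl _ = contradiction (Lr , Ut) (disjoint α r)
... | tri> _ _ t<r = contradiction (roundedL₂ α t r t<r Lr , Ut) (disjoint α t)

L? : ∀ α → Irrational α → Decidable (L α)
L? α irr r with irr r
... | inj₁ Lr = yes Lr
... | inj₂ Ur = no (λ Lr → disjoint α r (Lr , Ur))

-- An irrational α ∈ (0,1) lies strictly between consecutive fractions
-- D/(b+2) < α < D/(b+1), for every D ≥ 1.  Scan b = 0, 1, …: D/1 > α, while
-- D/(b+1) < γ < α once b ≥ D·den(γ), for a rational γ ∈ (0, α).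
bracket : ∀ α → Irrational α → InUnitInterval α → ∀ D → .{{_ : NonZero D}} →
          ∃ λ b → U α (frac D b) × L α (frac D (suc b))
bracket α irr (L0 , U1) D with roundedL₁ α 0ℚ L0
... | γ , 0<γ , Lγ =
  let b , _ , ¬Lb , L1+b = crossing (λ b → L? α irr (frac D b)) 0 (D * ↧ₙ γ) not-L-first L-far
  in  b , upper ¬Lb , L1+b
  where
  -- D/1 ≥ 1 > α
  not-L-first : ¬ L α (frac D 0)
  not-L-first L-D = <⇒≱ (frac<⇒ D 0 1ℚ (L<U α L-D U1)) (*-monoˡ-≤ 1 (>-nonZero⁻¹ D))
  0<num : 0 < ∣ ↥ γ ∣
  0<num = subst (0 <_) (*-identityʳ ∣ ↥ γ ∣) (frac<⇒ 0 0 γ 0<γ)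
  L-far : L α (frac D (D * ↧ₙ γ))
  L-far with irr (frac D (D * ↧ₙ γ))
  ... | inj₁ L-far = L-far
  ... | inj₂ U-far = contradiction (<frac⇒ D (D * ↧ₙ γ) γ 0<γ (L<U α Lγ U-far))
                       (≤⇒≯ (≤-trans (n≤1+n _) (m≤n*m (suc (D * ↧ₙ γ)) ∣ ↥ γ ∣ {{>-nonZero 0<num}})))
  upper : ∀ {b} → ¬ L α (frac D b) → U α (frac D b)
  upper {b} ¬Lb with irr (frac D b)
  ... | inj₁ Lb = contradiction Lb ¬Lb
  ... | inj₂ Ub = Ub

-- If D/(c+1) < α < D/c (here c = b+1) and x^(c+1) ≤ n^D < (x+1)^c, then ⌊n^α⌋ = x:
-- every rational r > α exceeds D/(c+1), so x ≤ n^r; and r = D/c witnesses n^α < x+1.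
floorPow-bracket : ∀ α n x D b → .{{_ : NonZero n}} → U α (frac D b) → L α (frac D (suc b)) →
                   x ^ suc (suc b) ≤ n ^ D → n ^ D < suc x ^ suc b → IsFloorPow n α x
floorPow-bracket α n x D b above below low high = atLeast , notAbove
  where
  c = suc b
  atLeast : LePow x n α
  atLeast r Ur = ^-cancelˡ-≤ (suc c) (begin
      (x ^ ↧ₙ r) ^ suc c     ≡⟨ ^-swap x (↧ₙ r) (suc c) ⟩
      (x ^ suc c) ^ ↧ₙ r     ≤⟨ ^-monoˡ-≤ (↧ₙ r) low ⟩
      (n ^ D) ^ ↧ₙ r         ≡⟨ ^-*-assoc n D (↧ₙ r) ⟩
      n ^ (D * ↧ₙ r)         ≤⟨ ^-monoʳ-≤ n (<⇒≤ (frac<⇒ D c r (L<U α below Ur))) ⟩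
      n ^ (∣ ↥ r ∣ * suc c)  ≡⟨ ^-*-assoc n ∣ ↥ r ∣ (suc c) ⟨
      (n ^ ∣ ↥ r ∣) ^ suc c  ∎)
    where open ≤-Reasoning
  notAbove : ¬ LePow (suc x) n α
  notAbove lePow = <-irrefl refl (begin-strict
      (suc x ^ d) ^ c   ≤⟨ ^-monoˡ-≤ c (lePow r above) ⟩
      (n ^ m) ^ c       ≡⟨ ^-*-assoc n m c ⟩
      n ^ (m * c)       ≡⟨ cong (n ^_) (frac-cross D b) ⟩
      n ^ (D * d)       ≡⟨ ^-*-assoc n D d ⟨
      (n ^ D) ^ d       <⟨ ^-monoˡ-< d high ⟩
      (suc x ^ c) ^ d   ≡⟨ ^-swap (suc x) c d ⟩
      (suc x ^ d) ^ c   ∎)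
    where
    open ≤-Reasoning
    r = frac D b
    m = ∣ ↥ r ∣
    d = ↧ₙ r

-- The quantitative use of α < 1: a number a with α < a/(a+1).  We only need its
-- effect on fractions below α, recorded by the following predicate.
SlopeBound : Real → ℕ → Set
SlopeBound α a = ∀ D c → L α (frac D c) → D * suc a ≤ suc c * a

-- Pick a rational β = m/d with α < β < 1; then m < d, so D/(c+1) < β gives
-- D·(m+1) ≤ D·d < m·(c+1).
slope-bound : ∀ α → InUnitInterval α → ∃ (SlopeBound α)
slope-bound α (L0 , U1) with roundedU₁ α 1ℚ U1
... | β , β<1 , Uβ = ∣ ↥ β ∣ , bound
  where
  m<d : ∣ ↥ β ∣ < ↧ₙ β
  m<d = subst₂ _<_ (*-identityʳ _) (*-identityˡ _) (<frac⇒ 1 0 β (L<U α L0 Uβ) β<1)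
  bound : SlopeBound α ∣ ↥ β ∣
  bound D c below = begin
    D * suc ∣ ↥ β ∣   ≤⟨ *-monoʳ-≤ D m<d ⟩
    D * ↧ₙ β          ≤⟨ <⇒≤ (frac<⇒ D c β (L<U α below Uβ)) ⟩
    ∣ ↥ β ∣ * suc c   ≡⟨ *-comm ∣ ↥ β ∣ (suc c) ⟩
    suc c * ∣ ↥ β ∣   ∎
    where open ≤-Reasoning

slope⇒≤ : ∀ α {a} → SlopeBound α a → ∀ D c → L α (frac D c) → D ≤ c
slope⇒≤ α {a} slope D c below = ≤-pred (*-cancelʳ-< (suc a) D (suc c) (begin-strict
    D * suc a      ≤⟨ slope D c below ⟩
    suc c * a      <⟨ *-monoʳ-< (suc c) (n<1+n a) ⟩
    suc c * suc a  ∎))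
  where open ≤-Reasoning

-- Bracketing α between D/(c+1) and D/c, the window lemma applies (its two
-- hypotheses come from power-gap and succ^-beats) and with floorPow-bracket yields a
-- block [y·H, (y+1)·H), y > x, of numbers n with ⌊n^α⌋ = x.
floorPow-block : ∀ α → Irrational α → InUnitInterval α → ∀ {a} → SlopeBound α a →
                 ∀ x E H → .{{_ : NonZero E}} → .{{_ : NonZero H}} → (4 * E * H) ^ a < x → 2 * x ≤ 2 ^ E →
                 ∃ λ y → x < y × (∀ n → y * H ≤ n → n < suc y * H → IsFloorPow n α x)
floorPow-block α irr unit {a} slope x E H Wᵃ<x 2x≤2ᴱ =
  let b , above , below    = bracket α irr unit D
      y , 4D<y , inWindow = window x (suc b) D H (gap below) (doubling below)
  in  y , x<y 4D<y , λ n lo hi →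
        let low , high = inWindow n lo hi
        in  floorPow-bracket α n x D b {{positive 4D<y lo}} above below low high
  where
  instance
    x≢0 : NonZero x
    x≢0 = >-nonZero (<-≤-trans z<s Wᵃ<x)
  D = x * E
  instance
    D≢0 : NonZero D
    D≢0 = m*n≢0 x E
  gap : ∀ {c} → L α (frac D c) → (4 * D * H) ^ D < x ^ suc c
  gap {c} below = subst (λ m → m ^ D < x ^ suc c) (4DH≡x·4EH x E H) (power-gap x (4 * E * H) a c D Wᵃ<x (slope D c below))
    where
    4DH≡x·4EH : ∀ x E H → x * (4 * E * H) ≡ 4 * (x * E) * H
    4DH≡x·4EH = solve-∀
  doubling : ∀ {c} → L α (frac D c) → 2 * x ^ suc c ≤ suc x ^ c
  doubling {c} below = succ^-beats x E c (slope⇒≤ α slope D c below) 2x≤2ᴱ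
  x<y : ∀ {y} → 4 * D < y → x < y
  x<y 4D<y = ≤-<-trans (≤-trans (m≤m*n x E) (m≤n*m D 4)) 4D<y
  positive : ∀ {y n} → 4 * D < y → y * H ≤ n → NonZero n
  positive {y} 4D<y yH≤n = >-nonZero (<-≤-trans (≤-<-trans z≤n 4D<y) (≤-trans (m≤m*n y H) yH≤n))

-- Choice of the exponent t, so that x = q^t exceeds N and (4·E·H)^a < x for E = tq+1.
-- Take t = (a+1)·u with u = 4 + C + N, C = 4·H·q·(a+2): then
-- 4·E·H ≤ C·u ≤ u² ≤ 2^u ≤ q^u, hence (4·E·H)^a ≤ q^(ua) < q^t.
exponent-choice : ∀ q → 1 < q → ∀ H a N → ∃ λ t → N < q ^ t × (4 * suc (t * q) * H) ^ a < q ^ t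
exponent-choice q 1<q H a N = t , N<qᵗ , Wᵃ<qᵗ
  where
  open ≤-Reasoning
  C = 4 * H * q * (2 + a)
  u = 4 + (C + N)
  t = suc a * u
  W≤q^u : 4 * suc (t * q) * H ≤ q ^ u
  W≤q^u = begin
    4 * suc (t * q) * H        ≤⟨ *-monoˡ-≤ H (*-monoʳ-≤ 4 (+-monoˡ-≤ (t * q) 1≤uq)) ⟩
    4 * (u * q + t * q) * H    ≡⟨ regroup a u q H ⟩
    C * u                      ≤⟨ *-monoˡ-≤ u (≤-trans (m≤m+n C N) (m≤n+m (C + N) 4)) ⟩
    u * u                      ≤⟨ square≤2^ (C + N) ⟩
    2 ^ u                      ≤⟨ ^-monoˡ-≤ u 1<q ⟩
    q ^ u                      ∎
    where
    1≤uq : 1 ≤ u * q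
    1≤uq = *-mono-≤ {1} {u} (s≤s z≤n) (<⇒≤ 1<q)
    regroup : ∀ a u q H → 4 * (u * q + suc a * u * q) * H ≡ 4 * H * q * (2 + a) * u
    regroup = solve-∀
  Wᵃ<qᵗ : (4 * suc (t * q) * H) ^ a < q ^ t
  Wᵃ<qᵗ = begin-strict
    (4 * suc (t * q) * H) ^ a  ≤⟨ ^-monoˡ-≤ a W≤q^u ⟩
    (q ^ u) ^ a                ≡⟨ ^-*-assoc q u a ⟩
    q ^ (u * a)                <⟨ ^-monoʳ-< q 1<q (subst (_< t) (*-comm a u) (m<n+m (a * u) z<s)) ⟩
    q ^ t                      ∎
  N<qᵗ : N < q ^ t
  N<qᵗ = begin-strict
    N      <⟨ s≤s (≤-trans (m≤n+m N C) (m≤n+m (C + N) 3)) ⟩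
    u      ≤⟨ m≤m+n u (a * u) ⟩
    t      <⟨ n<2^n t ⟩
    2 ^ t  ≤⟨ ^-monoˡ-≤ t 1<q ⟩
    q ^ t  ∎

-- Theorem 4.3.  With H = q^(k+2), choose x = q^t by exponent-choice and the block of
-- floorPow-block; its member n = (y followed by k+2 digits q-1) has ⌊n^α⌋ = x,
-- s_q(x) = 1 and s_q(n) ≥ k+2.
theorem4p3 : (q : ℕ) → .{{_ : NonZero q}} → 2 ≤ q →
    (α : Real) → Irrational α → InUnitInterval α →
    (k N : ℕ) → ∃ λ n → ∃ λ m →
    N < n × IsFloorPow n α m × suc k * s q m < s q n
theorem4p3 q 1<q α irr unit k N =
  let a , slope         = slope-bound α unit
      t , N<x , Wᵃ<x    = exponent-choice q 1<q H a N
      y , x<y , block   = floorPow-block α irr unit slope (q ^ t) (suc (t * q)) H Wᵃ<x (double-pow≤ q t)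
  in  appendMaxDigits j y , q ^ t ,
      <-trans N<x (<-≤-trans x<y (≤-trans (m≤m*n y H) (appendMaxDigits-lower j y))) ,
      block (appendMaxDigits j y) (appendMaxDigits-lower j y) (appendMaxDigits-upper j y) ,
      digits t y
  where
  open DigitSum q 1<q
  j = suc (suc k)
  H = q ^ j
  instance
    H≢0 : NonZero H
    H≢0 = m^n≢0 q j
  digits : ∀ t y → suc k * s q (q ^ t) < s q (appendMaxDigits j y)
  digits t y = begin-strict
    suc k * s q (q ^ t)  ≡⟨ cong (suc k *_) (s-pow t) ⟩
    suc k * 1            ≡⟨ *-identityʳ (suc k) ⟩
    suc k                <⟨ n<1+n (suc k) ⟩
    j                    ≤⟨ appendMaxDigits-s≥ j y ⟩
    s q (appendMaxDigits j y) ∎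
    where open ≤-Reasoning
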